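{- Let $X$ be a multigraph (multiple edges allowed) with no isolated vertices in which every vertex has even valency. Then every cyclic truncation of $X$ is class I.
   Context: Generalized truncation of $X$: for each edge $e=[u,v]$ of $X$ take a new edge (these form a matching $M_F$) whose two ends are labelled $u$ and $v$. For each vertex $v$, the cluster $\mathrm{cl}(v)$ is the set of ends labelled $v$ (of size $\mathrm{val}(v)$); insert a simple graph $\mathrm{con}(v)$ on $\mathrm{cl}(v)$. The result $M_F\cup\bigcup_v\mathrm{con}(v)$ is a generalized truncation. It is a cyclic truncation if every $\mathrm{con}(v)$ is a cycle passing through all vertices of $\mathrm{cl}(v)$ (so a cyclic truncation is $3$-regular). A graph is class I if its chromatic index equals its maximum valency. -}

module Defs where

open import Data.Nat using (ℕ; zero; suc; _+_; _*_; _≤_; _<_; _⊔_)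
open import Data.Nat.Divisibility using (_∣_)
open import Data.Nat.GeneralisedArithmetic using (iterate)
open import Data.Fin using (Fin; zero; suc; _≟_; combine; remQuot; join)
open import Data.List using (List; map; foldr; allFin)
open import Data.Nat.ListAction using (sum)
open import Data.Product using (Σ; ∃; ∃-syntax; _×_; _,_; proj₁; proj₂)
open import Data.Sum using (_⊎_; inj₁; inj₂)
open import Relation.Nullary using (¬_; yes; no)
open import Relation.Binary.PropositionalEquality using (_≡_; _≢_)
open import Function.Definitions using (Injective)

-- Finite multigraphs (multiple edges allowed; loops are representable
-- but excluded below where required).
-- Vertices are Fin nV, edges Fin nE; edge e has two ends i : Fin 2
-- with endpoint e i.

record Multigraph : Set where
  field
    nV : ℕ
    nE : ℕ
    endpoint : Fin nE → Fin 2 → Fin nV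

open Multigraph public

-- valency of v: number of edge-ends at v (a loop would count twice)
valency : (G : Multigraph) → Fin (nV G) → ℕ
valency G v =
  sum (map (λ e → sum (map (λ i → ind (endpoint G e i)) (allFin 2))) (allFin (nE G)))
  where
  ind : Fin (nV G) → ℕ
  ind w with w ≟ v
  ... | yes _ = 1
  ... | no _  = 0

-- maximum valency (0 for the graph without vertices)
maxValency : Multigraph → ℕ
maxValency G = foldr _⊔_ 0 (map (valency G) (allFin (nV G)))

Loopless : Multigraph → Set
Loopless G = ∀ e → endpoint G e zero ≢ endpoint G e (suc zero)

Adjacent : (G : Multigraph) → Fin (nE G) → Fin (nE G) → Set
Adjacent G e f = e ≢ f × ∃[ i ] ∃[ j ] endpoint G e i ≡ endpoint G f j

ProperEdgeColouring : (G : Multigraph) → (k : ℕ) → (Fin (nE G) → Fin k) → Set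
ProperEdgeColouring G k c = ∀ e f → Adjacent G e f → c e ≢ c f

EdgeColourable : Multigraph → ℕ → Set
EdgeColourable G k = Σ (Fin (nE G) → Fin k) (ProperEdgeColouring G k)

IsChromaticIndex : Multigraph → ℕ → Set
IsChromaticIndex G k = EdgeColourable G k × (∀ j → EdgeColourable G j → k ≤ j)

ClassI : Multigraph → Set
ClassI G = IsChromaticIndex G (maxValency G)

-- Cyclic truncations of X.
-- The ends of X are the pairs (e , i); end (e , i) is labelled
-- endpoint X e i, and cl(v) is the set of ends labelled v.

End : Multigraph → Set
End X = Fin (nE X) × Fin 2

label : (X : Multigraph) → End X → Fin (nV X)
label X (e , i) = endpoint X e i

-- A cyclic structure: for each cluster a cycle through all its ends,
-- given as a successor map succ on ends which preserves labels, is
-- injective (hence a permutation of each cluster), and is transitive on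
-- each cluster (a single cycle through all of cl(v)).
-- The edges of con(v) are then the pairs {x , succ x}, x ∈ cl(v).
record CyclicStructure (X : Multigraph) : Set where
  field
    succ       : End X → End X
    succ-label : ∀ x → label X (succ x) ≡ label X x
    succ-inj   : Injective _≡_ _≡_ succ
    succ-cyc   : ∀ x y → label X x ≡ label X y → ∃[ n ] iterate succ x n ≡ y

open CyclicStructure public

endIndex : (X : Multigraph) → End X → Fin (nE X * 2)
endIndex X (e , i) = combine e i

-- The cyclic truncation as a multigraph: vertices are the ends of X;
-- edges are the matching M_F (one per edge of X, indices in Fin nE)
-- followed by the cycle edges {x , succ x} (one per end x).
truncation : (X : Multigraph) → CyclicStructure X → Multigraph
truncation X C = record
  { nV = nE X * 2
  ; nE = nE X + nE X * 2
  ; endpoint = ep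
  }
  where
  ep' : Fin (nE X) ⊎ Fin (nE X * 2) → Fin 2 → Fin (nE X * 2)
  ep' (inj₁ e) i = combine e i
  ep' (inj₂ x) zero = x
  ep' (inj₂ x) (suc _) = endIndex X (succ C (remQuot 2 x))
  ep : Fin (nE X + nE X * 2) → Fin 2 → Fin (nE X * 2)
  ep k i = ep' (Data.Fin.splitAt (nE X) k) i

{-# OPTIONS --safe #-}

-- Every vertex of a cyclic truncation is the end of one matching edge and of two consecutive
-- edges of the cycle through its cluster, so the truncation is a loopless cubic graph and needs
-- at least 3 colours. As every valency of X is even, every cluster cycle has even length, so
-- the parity of the number of steps from a fixed end of a cluster along its cycle is well
-- defined and alternates along the cycle. Colouring the matching with one colour and each
-- cycle edge by this parity gives a proper 3-edge-colouring.
module Submission where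

open import Defs
open import Data.Nat using (ℕ; zero; suc; _+_; _*_; _≤_; _<_; _⊔_; z≤n; s≤s; parity)
open import Data.Nat.Properties
  using (+-comm; +-suc; +-assoc; +-identityʳ; ≤-total; ≤-reflexive; ≤-<-trans; m≤n+m; m≤n⇒∃[o]m+o≡n;
         m<1+n⇒m<n∨m≡n; ⊔-lub; m≥n⇒m⊔n≡m)
open import Data.Nat.DivMod using (_%_; _/_; m≡m%n+[m/n]*n; m%n<n)
open import Data.Nat.Divisibility using (_∣_; divides; ∣-trans; m%n≡0⇒n∣m)
open import Data.Nat.GeneralisedArithmetic using (iterate)
open import Data.Parity.Base using (Parity; 0ℙ; 1ℙ)
import Data.Parity.Base as ℙ
import Data.Parity.Properties as ℙ
open import Data.Fin using (Fin; zero; suc; toℕ; fromℕ<; _≟_; splitAt; join; remQuot)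
open import Data.Fin.Properties using (toℕ-injective; toℕ<n; toℕ-fromℕ<; injective⇒≤; cantor-schröder-bernstein;
  splitAt-join; join-splitAt; remQuot-combine; combine-remQuot)
open import Data.List using (List; []; _∷_; _++_; map; allFin; filter; length; lookup; cartesianProduct; foldr)
open import Data.List.Properties using (filter-++; length-++; map-cong)
open import Data.Nat.ListAction using (sum)
open import Data.List.Membership.Propositional using (_∈_)
open import Data.List.Membership.Propositional.Properties using (∈-filter⁺; ∈-filter⁻; ∈-cartesianProduct⁺; ∈-allFin; ∈-lookup)
open import Data.List.Relation.Unary.Any using (here; index)
open import Data.List.Relation.Unary.Any.Properties using (lookup-index)
import Data.List.Relation.Unary.All as All
open import Data.List.Relation.Unary.Unique.Propositional using (Unique; _∷_)
import Data.List.Relation.Unary.Unique.Propositional.Properties as Unique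
open import Data.Product.Properties using (≡-dec)
open import Data.Product using (Σ; ∃-syntax; _×_; _,_; proj₁; proj₂)
open import Data.Sum using (_⊎_; inj₁; inj₂)
import Data.Sum as Sum
open import Data.Empty using (⊥-elim)
open import Relation.Nullary using (¬_; yes; no; contradiction)
open import Relation.Unary using (Decidable)
open import Relation.Binary.Definitions using (DecidableEquality)
open import Relation.Binary.PropositionalEquality
open import Function.Definitions using (Injective)
open import Function.Base using (_∘_; case_of_)

private variable
  A : Set

-- Iteration, periods and parity

minimal-witness : {P : ℕ → Set} → Decidable P → ∀ {n} → P n → ∃[ m ] P m × (∀ {k} → k < m → ¬ P k)
minimal-witness {P} P? {n} = search 0 n (λ ())
  where
  search : ∀ b d → (∀ {k} → k < b → ¬ P k) → P (b + d) → ∃[ m ] P m × (∀ {k} → k < m → ¬ P k)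
  search b d below p with P? b
  ... | yes pb = b , pb , below
  search b zero below p | no ¬pb = contradiction (subst P (+-identityʳ b) p) ¬pb
  search b (suc d) below p | no ¬pb = search (suc b) d below′ (subst P (+-suc b d) p)
    where
    below′ : ∀ {k} → k < suc b → ¬ P k
    below′ k<1+b with m<1+n⇒m<n∨m≡n k<1+b
    ... | inj₁ k<b = below k<b
    ... | inj₂ refl = ¬pb

module _ {f : A → A} where

  iterate-suc : ∀ x n → iterate f (f x) n ≡ f (iterate f x n)
  iterate-suc x zero = refl
  iterate-suc x (suc n) = iterate-suc (f x) n

  iterate-+ : ∀ x m n → iterate f x (m + n) ≡ iterate f (iterate f x m) n
  iterate-+ x zero n = refl
  iterate-+ x (suc m) n = iterate-+ (f x) m n

  iterate-injective : Injective _≡_ _≡_ f → ∀ n → Injective _≡_ _≡_ (λ x → iterate f x n)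
  iterate-injective f-inj zero eq = eq
  iterate-injective f-inj (suc n) eq = f-inj (iterate-injective f-inj n eq)

  iterate-return : Injective _≡_ _≡_ f → ∀ x m k → iterate f x (m + k) ≡ iterate f x m → iterate f x k ≡ x
  iterate-return f-inj x m k eq = iterate-injective f-inj m (begin
    iterate f (iterate f x k) m ≡⟨ iterate-+ x k m ⟨
    iterate f x (k + m)         ≡⟨ cong (iterate f x) (+-comm k m) ⟩
    iterate f x (m + k)         ≡⟨ eq ⟩
    iterate f x m               ∎)
    where open ≡-Reasoning

module PeriodicPoint (_≟_ : DecidableEquality A) {f : A → A} (f-injective : Injective _≡_ _≡_ f)
                     (x : A) (returns : ∃[ n ] iterate f (f x) n ≡ x) where

  private
    least : ∃[ m ] iterate f (f x) m ≡ x × (∀ {k} → k < m → iterate f (f x) k ≢ x)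
    least = minimal-witness (λ k → iterate f (f x) k ≟ x) {proj₁ returns} (proj₂ returns)

  period : ℕ
  period = suc (proj₁ least)

  iterate-period : iterate f x period ≡ x
  iterate-period = proj₁ (proj₂ least)

  period-minimal : ∀ {d} → d < period → iterate f x d ≡ x → d ≡ 0
  period-minimal {zero} _ _ = refl
  period-minimal {suc d} (s≤s d<m) eq = contradiction eq (proj₂ (proj₂ least) d<m)

  iterate-*-period : ∀ q n → iterate f x (q * period + n) ≡ iterate f x n
  iterate-*-period zero n = refl
  iterate-*-period (suc q) n = begin
    iterate f x (period + q * period + n)           ≡⟨ cong (iterate f x) (+-assoc period (q * period) n) ⟩
    iterate f x (period + (q * period + n))         ≡⟨ iterate-+ x period (q * period + n) ⟩
    iterate f (iterate f x period) (q * period + n) ≡⟨ cong (λ y → iterate f y (q * period + n)) iterate-period ⟩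
    iterate f x (q * period + n)                    ≡⟨ iterate-*-period q n ⟩
    iterate f x n                                   ∎
    where open ≡-Reasoning

  iterate-%-period : ∀ n → iterate f x n ≡ iterate f x (n % period)
  iterate-%-period n = begin
    iterate f x n                                    ≡⟨ cong (iterate f x) (trans (m≡m%n+[m/n]*n n period) (+-comm (n % period) _)) ⟩
    iterate f x (n / period * period + n % period)   ≡⟨ iterate-*-period (n / period) (n % period) ⟩
    iterate f x (n % period)                         ∎
    where open ≡-Reasoning

  period-∣ : ∀ {d} → iterate f x d ≡ x → period ∣ d
  period-∣ {d} eq = m%n≡0⇒n∣m d period (period-minimal (m%n<n d period) (trans (sym (iterate-%-period d)) eq))

  private
    iterate-injective-≤ : ∀ {i j} → i ≤ j → j < period → iterate f x i ≡ iterate f x j → i ≡ j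
    iterate-injective-≤ {i} i≤j j<p eq with k , refl ← m≤n⇒∃[o]m+o≡n i≤j = begin
      i      ≡⟨ +-identityʳ i ⟨
      i + 0  ≡⟨ cong (i +_) (period-minimal (≤-<-trans (m≤n+m k i) j<p) (iterate-return f-injective x i k (sym eq))) ⟨
      i + k  ∎
      where open ≡-Reasoning

  iterate-injectiveʳ : ∀ {i j} → i < period → j < period → iterate f x i ≡ iterate f x j → i ≡ j
  iterate-injectiveʳ i<p j<p eq with ≤-total _ _
  ... | inj₁ i≤j = iterate-injective-≤ i≤j j<p eq
  ... | inj₂ j≤i = sym (iterate-injective-≤ j≤i i<p (sym eq))

parity-even : ∀ {n} → 2 ∣ n → parity n ≡ 0ℙ
parity-even (divides q refl) = trans (ℙ.*-homo-* q 2) (ℙ.*-zeroʳ (parity q))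

parity-+-even : ∀ m {k} → 2 ∣ k → parity (m + k) ≡ parity m
parity-+-even m {k} 2∣k = begin
  parity (m + k)            ≡⟨ ℙ.+-homo-+ m k ⟩
  parity m ℙ.+ parity k     ≡⟨ cong (parity m ℙ.+_) (parity-even 2∣k) ⟩
  parity m ℙ.+ 0ℙ           ≡⟨ ℙ.+-identityʳ (parity m) ⟩
  parity m                  ∎
  where open ≡-Reasoning

parity-suc≢ : ∀ n → parity (suc n) ≢ parity n
parity-suc≢ n eq = ℙ.p≢p⁻¹ (parity (suc n)) (trans eq (sym (ℙ.suc-homo-⁻¹ n)))

-- Ends at a vertex, valency and edge colourings

lookup-injective : ∀ {xs : List A} → Unique xs → Injective _≡_ _≡_ (lookup xs)
lookup-injective (_ ∷ _) {zero} {zero} _ = refl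
lookup-injective (x∉ ∷ _) {zero} {suc j} eq = contradiction eq (All.lookup x∉ (∈-lookup j))
lookup-injective (x∉ ∷ _) {suc i} {zero} eq = contradiction (sym eq) (All.lookup x∉ (∈-lookup i))
lookup-injective (_ ∷ u) {suc i} {suc j} eq = cong suc (lookup-injective u eq)

foldr-⊔-lub : ∀ {k} (f : A → ℕ) xs → (∀ x → f x ≤ k) → foldr _⊔_ 0 (map f xs) ≤ k
foldr-⊔-lub f [] f≤k = z≤n
foldr-⊔-lub f (x ∷ xs) f≤k = ⊔-lub (f≤k x) (foldr-⊔-lub f xs f≤k)

foldr-⊔-const : ∀ {r} (f : A → ℕ) xs → (∀ x → f x ≡ r) → foldr _⊔_ 0 (map f xs) ≡ r ⊎ xs ≡ []
foldr-⊔-const f [] f≡r = inj₂ refl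
foldr-⊔-const {r = r} f (x ∷ xs) f≡r = inj₁ (begin
  f x ⊔ foldr _⊔_ 0 (map f xs)  ≡⟨ cong (_⊔ _) (f≡r x) ⟩
  r ⊔ foldr _⊔_ 0 (map f xs)    ≡⟨ m≥n⇒m⊔n≡m (foldr-⊔-lub f xs (λ y → ≤-reflexive (f≡r y))) ⟩
  r                             ∎)
  where open ≡-Reasoning

module _ (G : Multigraph) (v : Fin (nV G)) where

  at? : Decidable (λ (x : End G) → label G x ≡ v)
  at? x = label G x ≟ v

  endsAt : List (End G)
  endsAt = filter at? (cartesianProduct (allFin (nE G)) (allFin 2))

  -- The per-edge summand of valency is an anonymous with-function of Defs; this names it.
  private
    valency-summand : Σ (Fin (nE G) → ℕ) λ F → valency G v ≡ sum (map F (allFin (nE G)))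
    valency-summand = _ , refl

    summand≡ : ∀ e → proj₁ valency-summand e ≡ length (filter at? (map (e ,_) (allFin 2)))
    summand≡ e with endpoint G e zero ≟ v
    ... | yes _ with endpoint G e (suc zero) ≟ v
    ...   | yes _ = refl
    ...   | no _ = refl
    summand≡ e | no _ with endpoint G e (suc zero) ≟ v
    ...   | yes _ = refl
    ...   | no _ = refl

  length-filter-cartesianProduct : ∀ xs → length (filter at? (cartesianProduct xs (allFin 2)))
                                 ≡ sum (map (λ e → length (filter at? (map (e ,_) (allFin 2)))) xs)
  length-filter-cartesianProduct [] = refl
  length-filter-cartesianProduct (e ∷ es) = begin
    length (filter at? (map (e ,_) (allFin 2) ++ cartesianProduct es (allFin 2)))
      ≡⟨ cong length (filter-++ at? (map (e ,_) (allFin 2)) _) ⟩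
    length (filter at? (map (e ,_) (allFin 2)) ++ filter at? (cartesianProduct es (allFin 2)))
      ≡⟨ length-++ (filter at? (map (e ,_) (allFin 2))) ⟩
    length (filter at? (map (e ,_) (allFin 2))) + length (filter at? (cartesianProduct es (allFin 2)))
      ≡⟨ cong (_ +_) (length-filter-cartesianProduct es) ⟩
    _ ∎
    where open ≡-Reasoning

  valency≡length-endsAt : valency G v ≡ length endsAt
  valency≡length-endsAt = begin
    valency G v                                       ≡⟨ proj₂ valency-summand ⟩
    sum (map (proj₁ valency-summand) (allFin (nE G))) ≡⟨ cong sum (map-cong summand≡ (allFin (nE G))) ⟩
    _                                                 ≡⟨ length-filter-cartesianProduct (allFin (nE G)) ⟨
    length endsAt                                     ∎
    where open ≡-Reasoning

  endsAt-unique : Unique endsAt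
  endsAt-unique = Unique.filter⁺ at? (Unique.cartesianProduct⁺ (Unique.allFin⁺ _) (Unique.allFin⁺ 2))

  ∈-endsAt⁺ : ∀ {x} → label G x ≡ v → x ∈ endsAt
  ∈-endsAt⁺ {e , i} = ∈-filter⁺ at? (∈-cartesianProduct⁺ (∈-allFin e) (∈-allFin i))

  ∈-endsAt⁻ : ∀ {x} → x ∈ endsAt → label G x ≡ v
  ∈-endsAt⁻ x∈ = proj₂ (∈-filter⁻ at? {xs = cartesianProduct (allFin (nE G)) (allFin 2)} x∈)

  enumeration⇒valency≡ : ∀ {p} (g : Fin p → End G) → Injective _≡_ _≡_ g → (∀ j → label G (g j) ≡ v) →
                         (∀ x → label G x ≡ v → ∃[ j ] g j ≡ x) → valency G v ≡ p
  enumeration⇒valency≡ g g-injective g-at g-onto =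
    trans (valency≡length-endsAt) (sym (cantor-schröder-bernstein position-injective entry-injective))
    where
    position : Fin _ → Fin (length endsAt)
    position j = index (∈-endsAt⁺ (g-at j))

    entry : Fin (length endsAt) → Fin _
    entry k = proj₁ (g-onto (lookup endsAt k) (∈-endsAt⁻ (∈-lookup k)))

    position-injective : Injective _≡_ _≡_ position
    position-injective {i} {j} eq = g-injective (begin
      g i                         ≡⟨ lookup-index (∈-endsAt⁺ (g-at i)) ⟩
      lookup endsAt (position i)  ≡⟨ cong (lookup endsAt) eq ⟩
      lookup endsAt (position j)  ≡⟨ lookup-index (∈-endsAt⁺ (g-at j)) ⟨
      g j                         ∎)
      where open ≡-Reasoning

    entry-injective : Injective _≡_ _≡_ entry
    entry-injective {k} {l} eq = lookup-injective (endsAt-unique) (begin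
      lookup endsAt k  ≡⟨ proj₂ (g-onto _ _) ⟨
      g (entry k)      ≡⟨ cong g eq ⟩
      g (entry l)      ≡⟨ proj₂ (g-onto _ _) ⟩
      lookup endsAt l  ∎)
      where open ≡-Reasoning

  positive-valency⇒end : 0 < valency G v → ∃[ x ] label G x ≡ v
  positive-valency⇒end 0<val =
    first endsAt (∈-endsAt⁻) (subst (0 <_) (valency≡length-endsAt) 0<val)
    where
    first : (xs : List (End G)) → (∀ {x} → x ∈ xs → label G x ≡ v) → 0 < length xs → ∃[ x ] label G x ≡ v
    first (x ∷ _) at _ = x , at (here refl)

module _ {G : Multigraph} where

  maxValency-regular : ∀ {r} → (∀ v → valency G v ≡ r) → maxValency G ≡ r ⊎ ¬ Fin (nV G)
  maxValency-regular regular with foldr-⊔-const (valency G) (allFin (nV G)) regular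
  ... | inj₁ max≡r = inj₁ max≡r
  ... | inj₂ none = inj₂ λ v → case subst (v ∈_) none (∈-allFin v) of λ ()

  module _ (loopless : Loopless G) where

    distinct-ends⇒distinct-edges : ∀ {x y : End G} → label G x ≡ label G y → x ≢ y → proj₁ x ≢ proj₁ y
    distinct-ends⇒distinct-edges {e , zero}     {_ , zero}     _  x≢y refl = x≢y refl
    distinct-ends⇒distinct-edges {e , zero}     {_ , suc zero} eq _   refl = loopless e eq
    distinct-ends⇒distinct-edges {e , suc zero} {_ , zero}     eq _   refl = loopless e (sym eq)
    distinct-ends⇒distinct-edges {e , suc zero} {_ , suc zero} _  x≢y refl = x≢y refl

    valency≤colours : ∀ {k} → EdgeColourable G k → ∀ v → valency G v ≤ k
    valency≤colours {k} (c , proper) v =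
      subst (_≤ k) (sym (valency≡length-endsAt G v)) (injective⇒≤ colourAt-injective)
      where
      end : Fin (length (endsAt G v)) → End G
      end = lookup (endsAt G v)

      colourAt : Fin (length (endsAt G v)) → Fin k
      colourAt j = c (proj₁ (end j))

      colourAt-injective : Injective _≡_ _≡_ colourAt
      colourAt-injective {i} {j} eq with i ≟ j
      ... | yes i≡j = i≡j
      ... | no i≢j = contradiction eq (proper _ _ (edges-distinct , proj₂ (end i) , proj₂ (end j) , same-vertex))
        where
        same-vertex : label G (end i) ≡ label G (end j)
        same-vertex = trans (∈-endsAt⁻ G v (∈-lookup i)) (sym (∈-endsAt⁻ G v (∈-lookup j)))
        edges-distinct : proj₁ (end i) ≢ proj₁ (end j)
        edges-distinct = distinct-ends⇒distinct-edges same-vertex (i≢j ∘ lookup-injective (endsAt-unique G v))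

    maxValency≤colours : ∀ {k} → EdgeColourable G k → maxValency G ≤ k
    maxValency≤colours colourable = foldr-⊔-lub (valency G) (allFin (nV G)) (valency≤colours colourable)

    regular-colourable⇒classI : ∀ {r} → (∀ v → valency G v ≡ r) → EdgeColourable G r → ClassI G
    regular-colourable⇒classI regular colourable = colourable-by-maxValency , λ _ → maxValency≤colours
      where
      colourable-by-maxValency : EdgeColourable G (maxValency G)
      colourable-by-maxValency with maxValency-regular regular
      ... | inj₁ max≡r = subst (EdgeColourable G) (sym max≡r) colourable
      ... | inj₂ no-vertex = (λ e → ⊥-elim (no-vertex (endpoint G e zero))) , λ e _ _ → ⊥-elim (no-vertex (endpoint G e zero))

-- The cycles of a cyclic structure

module Clusters (X : Multigraph) (C : CyclicStructure X) where

  private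
    s : End X → End X
    s = succ C

  _≟ₑ_ : DecidableEquality (End X)
  _≟ₑ_ = ≡-dec _≟_ _≟_

  iterate-label : ∀ x n → label X (iterate s x n) ≡ label X x
  iterate-label x zero = refl
  iterate-label x (suc n) = trans (iterate-label (s x) n) (succ-label C x)

  returns : ∀ x → ∃[ n ] iterate s (s x) n ≡ x
  returns x = succ-cyc C (s x) x (succ-label C x)

  module Orbit (x : End X) = PeriodicPoint _≟ₑ_ (succ-inj C) x (returns x)
  open Orbit using (period)

  valency≡period : ∀ x → valency X (label X x) ≡ period x
  valency≡period x = enumeration⇒valency≡ X (label X x) orbit orbit-injective orbit-label orbit-onto
    where
    open Orbit x using (iterate-injectiveʳ; iterate-%-period)

    orbit : Fin (period x) → End X
    orbit j = iterate s x (toℕ j)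

    orbit-injective : Injective _≡_ _≡_ orbit
    orbit-injective {i} {j} eq = toℕ-injective (iterate-injectiveʳ {toℕ i} {toℕ j} (toℕ<n i) (toℕ<n j) eq)

    orbit-label : ∀ j → label X (orbit j) ≡ label X x
    orbit-label j = iterate-label x (toℕ j)

    orbit-onto : ∀ y → label X y ≡ label X x → ∃[ j ] orbit j ≡ y
    orbit-onto y same with n , xₙ≡y ← succ-cyc C x y (sym same) =
      fromℕ< (m%n<n n (period x)) , (begin
        iterate s x (toℕ (fromℕ< (m%n<n n (period x))))  ≡⟨ cong (iterate s x) (toℕ-fromℕ< (m%n<n n (period x))) ⟩
        iterate s x (n % period x)                        ≡⟨ iterate-%-period n ⟨
        iterate s x n                                     ≡⟨ xₙ≡y ⟩
        y                                                 ∎)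
      where open ≡-Reasoning

  pred : End X → End X
  pred x = iterate s x (proj₁ (returns x))

  succ-pred : ∀ x → s (pred x) ≡ x
  succ-pred x = trans (sym (iterate-suc x (proj₁ (returns x)))) (proj₂ (returns x))

  pred-succ : ∀ x → pred (s x) ≡ x
  pred-succ x = succ-inj C (succ-pred (s x))

  module _ (even : ∀ v → 2 ∣ valency X v) where

    return-time-even : ∀ x {d} → iterate s x d ≡ x → 2 ∣ d
    return-time-even x returns-after-d =
      ∣-trans (subst (2 ∣_) (valency≡period x) (even (label X x))) (Orbit.period-∣ x returns-after-d)

    private
      iterate-parity-≤ : ∀ x {m n} → m ≤ n → iterate s x n ≡ iterate s x m → parity n ≡ parity m
      iterate-parity-≤ x {m} m≤n eq with k , refl ← m≤n⇒∃[o]m+o≡n m≤n =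
        parity-+-even m (return-time-even (iterate s x m) (trans (sym (iterate-+ x m k)) eq))

    iterate-parity : ∀ x {m n} → iterate s x m ≡ iterate s x n → parity m ≡ parity n
    iterate-parity x {m} {n} eq with ≤-total m n
    ... | inj₁ m≤n = sym (iterate-parity-≤ x m≤n (sym eq))
    ... | inj₂ n≤m = iterate-parity-≤ x n≤m eq

    module _ (nonisolated : ∀ v → 0 < valency X v) where

      anchor : Fin (nV X) → End X
      anchor v = proj₁ (positive-valency⇒end X v (nonisolated v))

      private
        reaches : ∀ x → ∃[ n ] iterate s (anchor (label X x)) n ≡ x
        reaches x = succ-cyc C _ x (proj₂ (positive-valency⇒end X (label X x) (nonisolated (label X x))))

      position : End X → ℕ
      position x = proj₁ (reaches x)

      iterate-position : ∀ x → iterate s (anchor (label X x)) (position x) ≡ x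
      iterate-position x = proj₂ (reaches x)

      alternation : End X → Parity
      alternation x = parity (position x)

      alternation-succ : ∀ x → alternation (s x) ≢ alternation x
      alternation-succ x =
        parity-suc≢ (position x) ∘ trans (sym (iterate-parity a {position (s x)} {suc (position x)} same-end))
        where
        a : End X
        a = anchor (label X x)
        iterate-position-succ : iterate s a (position (s x)) ≡ s x
        iterate-position-succ =
          subst (λ v → iterate s (anchor v) (position (s x)) ≡ s x) (succ-label C x) (iterate-position (s x))
        same-end : iterate s a (position (s x)) ≡ iterate s a (suc (position x))
        same-end = begin
          iterate s a (position (s x))    ≡⟨ iterate-position-succ ⟩
          s x                             ≡⟨ cong s (iterate-position x) ⟨
          s (iterate s a (position x))    ≡⟨ iterate-suc a (position x) ⟨
          iterate s a (suc (position x))  ∎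
          where open ≡-Reasoning

-- The cyclic truncation

module Truncation (X : Multigraph) (C : CyclicStructure X) where

  open Clusters X C using (pred; succ-pred; pred-succ)

  private
    T : Multigraph
    T = truncation X C

  TruncationEdge : Set
  TruncationEdge = Fin (nE X) ⊎ End X

  truncationEnd : TruncationEdge → Fin 2 → End X
  truncationEnd (inj₁ e) i = e , i
  truncationEnd (inj₂ x) zero = x
  truncationEnd (inj₂ x) (suc _) = succ C x

  edgeView : Fin (nE T) → TruncationEdge
  edgeView k = Sum.map₂ (remQuot 2) (splitAt (nE X) k)

  toEdge : TruncationEdge → Fin (nE T)
  toEdge a = join (nE X) (nE X * 2) (Sum.map₂ (endIndex X) a)

  endIndex-injective : Injective _≡_ _≡_ (endIndex X)
  endIndex-injective {x} {y} eq = trans (sym (remQuot-combine (proj₁ x) (proj₂ x)))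
                                        (trans (cong (remQuot 2) eq) (remQuot-combine (proj₁ y) (proj₂ y)))

  edgeView-toEdge : ∀ a → edgeView (toEdge a) ≡ a
  edgeView-toEdge a rewrite splitAt-join (nE X) (nE X * 2) (Sum.map₂ (endIndex X) a) with a
  ... | inj₁ e = refl
  ... | inj₂ (e , i) = cong inj₂ (remQuot-combine e i)

  toEdge-edgeView : ∀ k → toEdge (edgeView k) ≡ k
  toEdge-edgeView k =
    trans (cong (join (nE X) (nE X * 2)) (unview (splitAt (nE X) k))) (join-splitAt (nE X) (nE X * 2) k)
    where
    unview : ∀ b → Sum.map₂ (endIndex X) (Sum.map₂ (remQuot 2) b) ≡ b
    unview (inj₁ e) = refl
    unview (inj₂ w) = cong inj₂ (combine-remQuot {nE X} 2 w)

  edgeView-injective : Injective _≡_ _≡_ edgeView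
  edgeView-injective {k} {l} eq = trans (sym (toEdge-edgeView k)) (trans (cong toEdge eq) (toEdge-edgeView l))

  endpoint-truncation : ∀ k i → endpoint T k i ≡ endIndex X (truncationEnd (edgeView k) i)
  endpoint-truncation k i with splitAt (nE X) k
  ... | inj₁ e = refl
  ... | inj₂ w with i
  ...   | zero = sym (combine-remQuot {nE X} 2 w)
  ...   | suc zero = refl

  endpoint-toEdge : ∀ a i → endpoint T (toEdge a) i ≡ endIndex X (truncationEnd a i)
  endpoint-toEdge a i =
    trans (endpoint-truncation (toEdge a) i) (cong (λ b → endIndex X (truncationEnd b i)) (edgeView-toEdge a))

  toEdge-injective : Injective _≡_ _≡_ toEdge
  toEdge-injective {a} {b} eq = trans (sym (edgeView-toEdge a)) (trans (cong edgeView eq) (edgeView-toEdge b))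

  matching≢cycle : ∀ {e y} → toEdge (inj₁ e) ≢ toEdge (inj₂ y)
  matching≢cycle {e} {y} eq with toEdge-injective {inj₁ e} {inj₂ y} eq
  ... | ()

  truncation-loopless : (∀ x → succ C x ≢ x) → Loopless T
  truncation-loopless no-fixed-point k eq = no-loop (edgeView k) (endIndex-injective (begin
    endIndex X (truncationEnd (edgeView k) zero)        ≡⟨ endpoint-truncation k zero ⟨
    endpoint T k zero                                   ≡⟨ eq ⟩
    endpoint T k (suc zero)                             ≡⟨ endpoint-truncation k (suc zero) ⟩
    endIndex X (truncationEnd (edgeView k) (suc zero))  ∎))
    where
    open ≡-Reasoning
    no-loop : ∀ a → truncationEnd a zero ≢ truncationEnd a (suc zero)
    no-loop (inj₁ e) ()
    no-loop (inj₂ x) x≡sx = no-fixed-point x (sym x≡sx)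

  module _ (x : End X) where

    endsAtVertex : Fin 3 → End T
    endsAtVertex zero = toEdge (inj₁ (proj₁ x)) , proj₂ x
    endsAtVertex (suc zero) = toEdge (inj₂ x) , zero
    endsAtVertex (suc (suc zero)) = toEdge (inj₂ (pred x)) , suc zero

    endsAtVertex-label : ∀ j → label T (endsAtVertex j) ≡ endIndex X x
    endsAtVertex-label zero = endpoint-toEdge (inj₁ (proj₁ x)) (proj₂ x)
    endsAtVertex-label (suc zero) = endpoint-toEdge (inj₂ x) zero
    endsAtVertex-label (suc (suc zero)) =
      trans (endpoint-toEdge (inj₂ (pred x)) (suc zero)) (cong (endIndex X) (succ-pred x))

    endsAtVertex-injective : Injective _≡_ _≡_ endsAtVertex
    endsAtVertex-injective {zero} {zero} _ = refl
    endsAtVertex-injective {zero} {suc zero} eq = contradiction (cong proj₁ eq) matching≢cycle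
    endsAtVertex-injective {zero} {suc (suc zero)} eq = contradiction (cong proj₁ eq) matching≢cycle
    endsAtVertex-injective {suc zero} {zero} eq = contradiction (cong proj₁ (sym eq)) matching≢cycle
    endsAtVertex-injective {suc zero} {suc zero} _ = refl
    endsAtVertex-injective {suc zero} {suc (suc zero)} ()
    endsAtVertex-injective {suc (suc zero)} {zero} eq = contradiction (cong proj₁ (sym eq)) matching≢cycle
    endsAtVertex-injective {suc (suc zero)} {suc zero} ()
    endsAtVertex-injective {suc (suc zero)} {suc (suc zero)} _ = refl

    private
      onto-view : ∀ a i → truncationEnd a i ≡ x → ∃[ j ] endsAtVertex j ≡ (toEdge a , i)
      onto-view (inj₁ e) i refl = zero , refl
      onto-view (inj₂ y) zero refl = suc zero , refl
      onto-view (inj₂ y) (suc zero) refl = suc (suc zero) , cong (λ z → toEdge (inj₂ z) , suc zero) (pred-succ y)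

    endsAtVertex-onto : ∀ y → label T y ≡ endIndex X x → ∃[ j ] endsAtVertex j ≡ y
    endsAtVertex-onto (k , i) at-x
      with j , eq ← onto-view (edgeView k) i (endIndex-injective (trans (sym (endpoint-truncation k i)) at-x))
      = j , trans eq (cong (_, i) (toEdge-edgeView k))

  truncation-cubic : ∀ w → valency T w ≡ 3
  truncation-cubic w = subst (λ v → valency T v ≡ 3) (combine-remQuot {nE X} 2 w)
    (enumeration⇒valency≡ T _ (endsAtVertex x) (endsAtVertex-injective x) (endsAtVertex-label x) (endsAtVertex-onto x))
    where
    x : End X
    x = remQuot 2 w

  module _ (colour : End X → Parity) (alternating : ∀ x → colour (succ C x) ≢ colour x) where

    cycleColour : Parity → Fin 3
    cycleColour 0ℙ = suc zero
    cycleColour 1ℙ = suc (suc zero)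

    cycleColour-injective : Injective _≡_ _≡_ cycleColour
    cycleColour-injective {0ℙ} {0ℙ} _ = refl
    cycleColour-injective {1ℙ} {1ℙ} _ = refl

    cycleColour≢0 : ∀ p → cycleColour p ≢ zero
    cycleColour≢0 0ℙ ()
    cycleColour≢0 1ℙ ()

    edgeColour : TruncationEdge → Fin 3
    edgeColour (inj₁ _) = zero
    edgeColour (inj₂ x) = cycleColour (colour x)

    edgeColour-proper : ∀ {a b} i j → a ≢ b → truncationEnd a i ≡ truncationEnd b j → edgeColour a ≢ edgeColour b
    edgeColour-proper {inj₁ e} {inj₁ e′} i j a≢b refl _ = a≢b refl
    edgeColour-proper {inj₁ _} {inj₂ y} _ _ _ _ = cycleColour≢0 (colour y) ∘ sym
    edgeColour-proper {inj₂ x} {inj₁ _} _ _ _ _ = cycleColour≢0 (colour x)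
    edgeColour-proper {inj₂ x} {inj₂ y} zero zero a≢b x≡y _ = a≢b (cong inj₂ x≡y)
    edgeColour-proper {inj₂ x} {inj₂ y} zero (suc zero) _ refl = alternating y ∘ cycleColour-injective
    edgeColour-proper {inj₂ x} {inj₂ y} (suc zero) zero _ refl = alternating x ∘ cycleColour-injective ∘ sym
    edgeColour-proper {inj₂ x} {inj₂ y} (suc zero) (suc zero) a≢b sx≡sy _ = a≢b (cong inj₂ (succ-inj C sx≡sy))

    truncation-colourable : EdgeColourable T 3
    truncation-colourable = edgeColour ∘ edgeView , λ k l (k≢l , i , j , same-vertex) →
      edgeColour-proper i j (k≢l ∘ edgeView-injective)
        (endIndex-injective (trans (sym (endpoint-truncation k i)) (trans same-vertex (endpoint-truncation l j))))

corollary5p2 : (X : Multigraph) → Loopless X →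
    (∀ v → 0 < valency X v) →
    (∀ v → 2 ∣ valency X v) →
    (C : CyclicStructure X) → ClassI (truncation X C)
corollary5p2 X _ nonisolated even C =
  regular-colourable⇒classI (truncation-loopless no-fixed-point) truncation-cubic
    (truncation-colourable colour alternating)
  where
  open Truncation X C
  colour : End X → Parity
  colour = Clusters.alternation X C even nonisolated
  alternating : ∀ x → colour (succ C x) ≢ colour x
  alternating = Clusters.alternation-succ X C even nonisolated
  no-fixed-point : ∀ x → succ C x ≢ x
  no-fixed-point x = alternating x ∘ cong colour
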